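{- Let $Q$ be a quiver with two vertices $v_1,v_2$ and $a>0$ arrows from $v_1$ to $v_2$, and let $\boldsymbol b=(b_1,b_2)$ be an integer vector. Then: (1) if $a=1$, $\boldsymbol b$ is admissible for any $b_1,b_2$ (not both zero); (2) if $a=2$, $\boldsymbol b$ is admissible if and only if $b_1=-b_2\le0$ (and $\boldsymbol b\ne 0$); (3) if $a>2$, there are no admissible vectors.
   Context: $b_{ij}$ is the number of arrows $v_i\to v_j$ (negative if reversed); mutation $\mu_k$: $b'_{ij}=-b_{ij}$ if $k\in\{i,j\}$, else $b'_{ij}=b_{ij}+\mathrm{sgn}(b_{ik})[b_{ik}b_{kj}]_+$. For a quiver $Q$ on mutable vertices and an integer vector $\boldsymbol b$, add a frozen vertex $q$ with $b_i$ arrows from $v_i$ to $q$; mutations only at mutable vertices. $\boldsymbol b$ is admissible if $\boldsymbol b\neq0$ and the resulting quiver with frozen vertex has finite mutation class. -}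

module Defs where

open import Data.Nat using (ℕ)
open import Data.Integer using (ℤ; +_; -_; _+_; _*_; _⊔_; _<_; 0ℤ; 1ℤ; -1ℤ; _≤_)
open import Data.Integer.Properties using (_<?_)
open import Data.Fin using (Fin; zero; suc; _≟_; inject₁)
open import Data.List using (List)
open import Data.List.Relation.Unary.Any using (Any)
open import Data.Product using (_×_; ∃)
open import Relation.Nullary using (¬_; yes; no)
open import Relation.Binary.PropositionalEquality using (_≡_)

-- An exchange matrix on 3 vertices: indices 0,1 are the mutable vertices
-- v₁, v₂ and index 2 is the frozen vertex q.  b i j = number of arrows
-- i → j (negative if reversed).
Matrix : Set
Matrix = Fin 3 → Fin 3 → ℤ

sgn : ℤ → ℤ
sgn x with 0ℤ <? x
... | yes _ = 1ℤ
... | no _ with x <? 0ℤ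
...   | yes _ = -1ℤ
...   | no _ = 0ℤ

[_]₊ : ℤ → ℤ
[ x ]₊ = x ⊔ 0ℤ

mutate : Fin 3 → Matrix → Matrix
mutate k b i j with i ≟ k | j ≟ k
... | yes _ | _     = - b i j
... | no _  | yes _ = - b i j
... | no _  | no _  = b i j + sgn (b i k) * [ b i k * b k j ]₊

data Reachable (b : Matrix) : Matrix → Set where
  here : Reachable b b
  step : ∀ {c} → Reachable b c → (k : Fin 2) → Reachable b (mutate (inject₁ k) c)

_≐_ : Matrix → Matrix → Set
b ≐ c = ∀ i j → b i j ≡ c i j

FiniteMutationClass : Matrix → Set
FiniteMutationClass b = ∃ λ (L : List Matrix) → ∀ c → Reachable b c → Any (c ≐_) L

quiverWithFrozen : ℕ → ℤ → ℤ → Matrix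
quiverWithFrozen a b₁ b₂ zero          zero          = 0ℤ
quiverWithFrozen a b₁ b₂ zero          (suc zero)    = + a
quiverWithFrozen a b₁ b₂ zero          (suc (suc _)) = b₁
quiverWithFrozen a b₁ b₂ (suc zero)    zero          = - (+ a)
quiverWithFrozen a b₁ b₂ (suc zero)    (suc zero)    = 0ℤ
quiverWithFrozen a b₁ b₂ (suc zero)    (suc (suc _)) = b₂
quiverWithFrozen a b₁ b₂ (suc (suc _)) zero          = - b₁
quiverWithFrozen a b₁ b₂ (suc (suc _)) (suc zero)    = - b₂
quiverWithFrozen a b₁ b₂ (suc (suc _)) (suc (suc _)) = 0ℤ

Admissible : ℕ → ℤ → ℤ → Set
Admissible a b₁ b₂ = ¬ (b₁ ≡ 0ℤ × b₂ ≡ 0ℤ) × FiniteMutationClass (quiverWithFrozen a b₁ b₂)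

-- Write x, y for the numbers of arrows v₁ → q, v₂ → q and A = a > 0.  Mutating
-- quiverWithFrozen a x y at v₁ or v₂ gives the arrow-reversal of quiverWithFrozen a x′ y′,
-- where (x′, y′) = μ₁ (x, y) = (x, A[-x]₊ - y) or μ₂ (x, y) = (-x - A[y]₊, y), and reversing
-- all arrows commutes with mutation.  So the mutation class is finite exactly when the
-- orbit of (b₁, b₂) under the piecewise-linear involutions μ₁, μ₂ is finite.
--
-- For a = 1 the orbit stays in the box |x|, |y|, |x + y| ≤ K, x - y ≤ K with K = |b₁| + |b₂|.
-- For a = 2 and b₁ = -b₂ ≤ 0 the vector is fixed by both maps.  In every other case with
-- a ≥ 2, at most two mutations bring the vector into the cone x < 0, x + y < 0, or into
-- its mirror image under (x, y) ↦ (-y, -x), which conjugates μ₁ and μ₂.  On that cone μ₂μ₁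
-- strictly increases -x and preserves the cone, so the orbit is unbounded.  The antidiagonal
-- y = -x > 0 reaches the mirrored cone only when a ≥ 3.

module Submission where

open import Data.Empty using (⊥-elim)
open import Data.Fin using (Fin; zero; suc; _≟_; inject₁)
open import Data.Integer
  using (ℤ; +_; -[1+_]; +[1+_]; -_; _+_; _-_; _*_; _⊔_; ∣_∣; 0ℤ; 1ℤ; -1ℤ; _≤_; _<_; +≤+; -≤+)
open import Data.Integer.Base using (nonNegative)
import Data.Integer.Properties as ℤ
open import Algebra.Properties.AbelianGroup ℤ.+-0-abelianGroup using (inverseˡ-unique; inverseʳ-unique)
open import Data.Integer.Tactic.RingSolver using (solve; solve-∀)
open import Data.List using (List; []; _∷_; _++_; map; upTo; cartesianProduct)
open import Data.List.Membership.Propositional using (_∈_)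
open import Data.List.Membership.Propositional.Properties
  using (∈-map⁺; ∈-++⁺ˡ; ∈-++⁺ʳ; ∈-upTo⁺; ∈-cartesianProduct⁺)
open import Data.List.Relation.Unary.Any using (Any; here; there)
import Data.List.Relation.Unary.Any as Any
open import Data.List.Relation.Unary.Any.Properties using (++⁺ˡ; ++⁺ʳ; map⁺)
open import Data.Nat using (ℕ; zero; suc; z≤n; _>_)
import Data.Nat as ℕ
import Data.Nat.Properties as ℕ
open import Data.Nat.ListAction using (sum)
open import Data.Product using (_×_; _,_; proj₁; ∃-syntax)
open import Data.Sum using (_⊎_; inj₁; inj₂)
open import Function using (_∘_)
open import Function.Bundles using (_⇔_; mk⇔)
open import Relation.Binary.Definitions using (tri<; tri≈; tri>)
open import Relation.Binary.PropositionalEquality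
open import Relation.Nullary using (¬_; yes; no)
open import Relation.Nullary.Decidable using (decidable-stable; _×-dec_)

open import Defs

open ≡-Reasoning

sgn-neg : ∀ u → sgn (- u) ≡ - sgn u
sgn-neg (+ zero)  = refl
sgn-neg +[1+ n ]  = refl
sgn-neg -[1+ n ]  = refl

sgn-[]₊ : ∀ u → sgn u * [ u ]₊ ≡ [ u ]₊
sgn-[]₊ (+ zero)  = refl
sgn-[]₊ +[1+ n ]  = ℤ.*-identityˡ _
sgn-[]₊ -[1+ n ]  = refl

*-distribˡ-[]₊ : ∀ {A} → 0ℤ ≤ A → ∀ u → [ A * u ]₊ ≡ A * [ u ]₊
*-distribˡ-[]₊ {A} 0≤A u = begin
  A * u ⊔ 0ℤ        ≡⟨ cong (A * u ⊔_) (ℤ.*-zeroʳ A) ⟨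
  A * u ⊔ A * 0ℤ    ≡⟨ ℤ.*-distribˡ-⊔-nonNeg A u 0ℤ ⟨
  A * [ u ]₊        ∎
  where instance _ = nonNegative 0≤A

sgn-[*]₊-nonneg : ∀ {A} → 0ℤ ≤ A → ∀ u → sgn u * [ u * A ]₊ ≡ A * [ u ]₊
sgn-[*]₊-nonneg {A} 0≤A u = begin
  sgn u * [ u * A ]₊        ≡⟨ cong (λ v → sgn u * [ v ]₊) (ℤ.*-comm u A) ⟩
  sgn u * [ A * u ]₊        ≡⟨ cong (sgn u *_) (*-distribˡ-[]₊ 0≤A u) ⟩
  sgn u * (A * [ u ]₊)      ≡⟨ ℤ.*-assoc (sgn u) A _ ⟨
  sgn u * A * [ u ]₊        ≡⟨ cong (_* [ u ]₊) (ℤ.*-comm (sgn u) A) ⟩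
  A * sgn u * [ u ]₊        ≡⟨ ℤ.*-assoc A (sgn u) _ ⟩
  A * (sgn u * [ u ]₊)      ≡⟨ cong (A *_) (sgn-[]₊ u) ⟩
  A * [ u ]₊                ∎

sgn-[*-]₊ : ∀ u → sgn (- u) * [ - u * u ]₊ ≡ 0ℤ
sgn-[*-]₊ (+ zero)  = refl
sgn-[*-]₊ +[1+ n ]  = refl
sgn-[*-]₊ -[1+ n ]  = refl

sgn-[neg*neg]₊ : ∀ u w → sgn (- u) * [ - u * - w ]₊ ≡ - (sgn u * [ u * w ]₊)
sgn-[neg*neg]₊ u w = begin
  sgn (- u) * [ - u * - w ]₊   ≡⟨ cong (λ v → sgn (- u) * [ v ]₊) (neg*neg u w) ⟩
  sgn (- u) * [ u * w ]₊       ≡⟨ cong (_* [ u * w ]₊) (sgn-neg u) ⟩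
  - sgn u * [ u * w ]₊         ≡⟨ ℤ.neg-distribˡ-* (sgn u) _ ⟨
  - (sgn u * [ u * w ]₊)       ∎
  where
  neg*neg : ∀ u w → - u * - w ≡ u * w
  neg*neg = solve-∀

-- Mutation acts on the frozen vector

neg : Matrix → Matrix
neg b i j = - b i j

≐-trans : ∀ {b c d} → b ≐ c → c ≐ d → b ≐ d
≐-trans b≐c c≐d i j = trans (b≐c i j) (c≐d i j)

neg-cong : ∀ {b c} → b ≐ c → neg b ≐ neg c
neg-cong b≐c i j = cong -_ (b≐c i j)

neg-involutive : ∀ b → neg (neg b) ≐ b
neg-involutive b i j = ℤ.neg-involutive (b i j)

mutate-cong : ∀ k {b c} → b ≐ c → mutate k b ≐ mutate k c
mutate-cong k {b} {c} b≐c i j with i ≟ k | j ≟ k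
... | yes _ | _     = cong -_ (b≐c i j)
... | no _  | yes _ = cong -_ (b≐c i j)
... | no _  | no _  rewrite b≐c i j | b≐c i k | b≐c k j = refl

mutate-neg : ∀ k b → mutate k (neg b) ≐ neg (mutate k b)
mutate-neg k b i j with i ≟ k | j ≟ k
... | yes _ | _     = refl
... | no _  | yes _ = refl
... | no _  | no _  = begin
  - b i j + sgn (- b i k) * [ - b i k * - b k j ]₊  ≡⟨ cong (λ v → - b i j + v) (sgn-[neg*neg]₊ (b i k) (b k j)) ⟩
  - b i j + - (sgn (b i k) * [ b i k * b k j ]₊)    ≡⟨ ℤ.neg-distrib-+ (b i j) _ ⟨
  - (b i j + sgn (b i k) * [ b i k * b k j ]₊)      ∎

Q : ℕ → ℤ × ℤ → Matrix
Q a (x , y) = quiverWithFrozen a x y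

μ : ℤ → Fin 2 → ℤ × ℤ → ℤ × ℤ
μ A zero       (x , y) = x , A * [ - x ]₊ - y
μ A (suc zero) (x , y) = - x - A * [ y ]₊ , y

mutate-Q₁ : ∀ n t → mutate zero (Q (suc n) t) ≐ neg (Q (suc n) (μ (+ suc n) zero t))
mutate-Q₁ n (x , y) zero zero = refl
mutate-Q₁ n (x , y) zero (suc zero) = refl
mutate-Q₁ n (x , y) zero (suc (suc zero)) = refl
mutate-Q₁ n (x , y) (suc zero) zero = refl
mutate-Q₁ n (x , y) (suc zero) (suc zero) = refl
mutate-Q₁ n (x , y) (suc zero) (suc (suc zero)) = begin
  y + -1ℤ * [ - +[1+ n ] * x ]₊      ≡⟨ cong (λ v → y + -1ℤ * [ v ]₊) (ℤ.neg-distribˡ-* +[1+ n ] x) ⟨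
  y + -1ℤ * [ - (+[1+ n ] * x) ]₊    ≡⟨ cong (λ v → y + -1ℤ * [ v ]₊) (ℤ.neg-distribʳ-* +[1+ n ] x) ⟩
  y + -1ℤ * [ +[1+ n ] * - x ]₊      ≡⟨ cong (λ v → y + -1ℤ * v) (*-distribˡ-[]₊ {+[1+ n ]} (+≤+ z≤n) (- x)) ⟩
  y + -1ℤ * (+[1+ n ] * [ - x ]₊)    ≡⟨ ring₁ y (+[1+ n ] * [ - x ]₊) ⟩
  - (+[1+ n ] * [ - x ]₊ - y)        ∎
  where
  ring₁ : ∀ y v → y + -1ℤ * v ≡ - (v - y)
  ring₁ = solve-∀
mutate-Q₁ n (x , y) (suc (suc zero)) zero = refl
mutate-Q₁ n (x , y) (suc (suc zero)) (suc zero) = begin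
  - y + sgn (- x) * [ - x * +[1+ n ] ]₊  ≡⟨ cong (λ v → - y + v) (sgn-[*]₊-nonneg {+[1+ n ]} (+≤+ z≤n) (- x)) ⟩
  - y + +[1+ n ] * [ - x ]₊              ≡⟨ ring₂ y (+[1+ n ] * [ - x ]₊) ⟩
  - (- (+[1+ n ] * [ - x ]₊ - y))        ∎
  where
  ring₂ : ∀ y v → - y + v ≡ - (- (v - y))
  ring₂ = solve-∀
mutate-Q₁ n (x , y) (suc (suc zero)) (suc (suc zero)) = trans (ℤ.+-identityˡ _) (sgn-[*-]₊ x)

mutate-Q₂ : ∀ n t → mutate (suc zero) (Q (suc n) t) ≐ neg (Q (suc n) (μ (+ suc n) (suc zero) t))
mutate-Q₂ n (x , y) zero zero = refl
mutate-Q₂ n (x , y) zero (suc zero) = refl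
mutate-Q₂ n (x , y) zero (suc (suc zero)) = begin
  x + 1ℤ * [ +[1+ n ] * y ]₊     ≡⟨ cong (λ v → x + 1ℤ * v) (*-distribˡ-[]₊ {+[1+ n ]} (+≤+ z≤n) y) ⟩
  x + 1ℤ * (+[1+ n ] * [ y ]₊)   ≡⟨ ring₃ x (+[1+ n ] * [ y ]₊) ⟩
  - (- x - +[1+ n ] * [ y ]₊)    ∎
  where
  ring₃ : ∀ x v → x + 1ℤ * v ≡ - (- x - v)
  ring₃ = solve-∀
mutate-Q₂ n (x , y) (suc zero) zero = refl
mutate-Q₂ n (x , y) (suc zero) (suc zero) = refl
mutate-Q₂ n (x , y) (suc zero) (suc (suc zero)) = refl
mutate-Q₂ n (x , y) (suc (suc zero)) zero = begin
  - x + sgn (- y) * [ - y * - +[1+ n ] ]₊  ≡⟨ cong (λ v → - x + v) (sgn-[neg*neg]₊ y +[1+ n ]) ⟩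
  - x + - (sgn y * [ y * +[1+ n ] ]₊)      ≡⟨ cong (λ v → - x + - v) (sgn-[*]₊-nonneg {+[1+ n ]} (+≤+ z≤n) y) ⟩
  - x + - (+[1+ n ] * [ y ]₊)              ≡⟨ ring₄ x (+[1+ n ] * [ y ]₊) ⟩
  - (- (- x - +[1+ n ] * [ y ]₊))          ∎
  where
  ring₄ : ∀ x v → - x + - v ≡ - (- (- x - v))
  ring₄ = solve-∀
mutate-Q₂ n (x , y) (suc (suc zero)) (suc zero) = refl
mutate-Q₂ n (x , y) (suc (suc zero)) (suc (suc zero)) = trans (ℤ.+-identityˡ _) (sgn-[*-]₊ y)

mutate-Q : ∀ n k t → mutate (inject₁ k) (Q (suc n) t) ≐ neg (Q (suc n) (μ (+ suc n) k t))
mutate-Q n zero       = mutate-Q₁ n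
mutate-Q n (suc zero) = mutate-Q₂ n

_≐±_ : Matrix → Matrix → Set
c ≐± d = c ≐ d ⊎ c ≐ neg d

mutate-≐±Q : ∀ n k {c} t → c ≐± Q (suc n) t → mutate (inject₁ k) c ≐± Q (suc n) (μ (+ suc n) k t)
mutate-≐±Q n k t (inj₁ c≐Q)  = inj₂ (≐-trans (mutate-cong _ c≐Q) (mutate-Q n k t))
mutate-≐±Q n k t (inj₂ c≐-Q) = inj₁ (≐-trans (mutate-cong _ c≐-Q) (≐-trans (mutate-neg _ _)
                                 (≐-trans (neg-cong (mutate-Q n k t)) (neg-involutive _))))

data Orbit (A : ℤ) (s : ℤ × ℤ) : ℤ × ℤ → Set where
  here : Orbit A s s
  step : ∀ {t} → Orbit A s t → (k : Fin 2) → Orbit A s (μ A k t)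

reachable⇒orbit : ∀ {n s c} → Reachable (Q (suc n) s) c → ∃[ t ] Orbit (+ suc n) s t × c ≐± Q (suc n) t
reachable⇒orbit here = _ , here , inj₁ (λ _ _ → refl)
reachable⇒orbit (step r k) with reachable⇒orbit r
... | t , o , c≐±Q = _ , step o k , mutate-≐±Q _ k t c≐±Q

orbit⇒reachable : ∀ {n s t} → Orbit (+ suc n) s t → ∃[ c ] Reachable (Q (suc n) s) c × c ≐± Q (suc n) t
orbit⇒reachable here = _ , here , inj₁ (λ _ _ → refl)
orbit⇒reachable (step o k) with orbit⇒reachable o
... | c , r , c≐±Q = _ , step r k , mutate-≐±Q _ k _ c≐±Q

finite-orbit⇒finite-class : ∀ {n s} (L : List (ℤ × ℤ)) → (∀ {t} → Orbit (+ suc n) s t → t ∈ L) →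
                            FiniteMutationClass (Q (suc n) s)
finite-orbit⇒finite-class {n} L orbit⊆L = map (Q (suc n)) L ++ map (neg ∘ Q (suc n)) L , covered
  where
  covered : ∀ c → Reachable _ c → Any (c ≐_) (map (Q (suc n)) L ++ map (neg ∘ Q (suc n)) L)
  covered c r with reachable⇒orbit r
  ... | t , o , inj₁ c≐Q  = ++⁺ˡ (map⁺ (Any.map (λ { refl → c≐Q }) (orbit⊆L o)))
  ... | t , o , inj₂ c≐-Q = ++⁺ʳ _ (map⁺ (Any.map (λ { refl → c≐-Q }) (orbit⊆L o)))

‖_‖ : ℤ × ℤ → ℕ
‖ x , y ‖ = ∣ x ∣ ℕ.+ ∣ y ∣

frozenNorm : Matrix → ℕ
frozenNorm c = ∣ c zero (suc (suc zero)) ∣ ℕ.+ ∣ c (suc zero) (suc (suc zero)) ∣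

frozenNorm-≐ : ∀ {b c} → b ≐ c → frozenNorm b ≡ frozenNorm c
frozenNorm-≐ b≐c = cong₂ (λ u v → ∣ u ∣ ℕ.+ ∣ v ∣) (b≐c _ _) (b≐c _ _)

frozenNorm-≐±Q : ∀ {a c} t → c ≐± Q a t → frozenNorm c ≡ ‖ t ‖
frozenNorm-≐±Q t (inj₁ c≐Q)        = frozenNorm-≐ c≐Q
frozenNorm-≐±Q (x , y) (inj₂ c≐-Q) =
  trans (frozenNorm-≐ c≐-Q) (cong₂ ℕ._+_ (ℤ.∣-i∣≡∣i∣ x) (ℤ.∣-i∣≡∣i∣ y))

frozenNorm-≤-sum : ∀ {c} L → Any (c ≐_) L → frozenNorm c ℕ.≤ sum (map frozenNorm L)
frozenNorm-≤-sum (d ∷ L) (here c≐d)  = ℕ.≤-trans (ℕ.≤-reflexive (frozenNorm-≐ c≐d)) (ℕ.m≤m+n _ _)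
frozenNorm-≤-sum (d ∷ L) (there c∈L) = ℕ.≤-trans (frozenNorm-≤-sum L c∈L) (ℕ.m≤n+m _ _)

Unbounded : ℤ → ℤ × ℤ → Set
Unbounded A s = ∀ m → ∃[ t ] Orbit A s t × m ℕ.≤ ‖ t ‖

unbounded-orbit⇒infinite-class : ∀ {n s} → Unbounded (+ suc n) s → ¬ FiniteMutationClass (Q (suc n) s)
unbounded-orbit⇒infinite-class unbounded (L , covered) with unbounded (suc (sum (map frozenNorm L)))
... | t , o , large with orbit⇒reachable o
... | c , r , c≐±Q = ℕ.<⇒≱ large
  (subst (ℕ._≤ sum (map frozenNorm L)) (frozenNorm-≐±Q t c≐±Q) (frozenNorm-≤-sum L (covered c r)))

*-nonneg : ∀ {i j} → 0ℤ ≤ i → 0ℤ ≤ j → 0ℤ ≤ i * j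
*-nonneg {+ m} {+ n} _ _ = subst (0ℤ ≤_) (ℤ.pos-* m n) (+≤+ z≤n)

-- The inequality comes first so that the goal handed to the ring solver has no metavariables.
0≤-by : ∀ {i j} → 0ℤ ≤ i → i ≡ j → 0ℤ ≤ j
0≤-by 0≤i refl = 0≤i

0<-by : ∀ {i j} → 0ℤ < i → i ≡ j → 0ℤ < j
0<-by 0<i refl = 0<i

<-by : ∀ {d i j} → 0ℤ < d → i + d ≡ j → i < j
<-by {d} {i} 0<d refl = subst (_< i + d) (ℤ.+-identityʳ i) (ℤ.+-mono-≤-< (ℤ.≤-refl {i}) 0<d)

0≤-i⇒i≤0 : ∀ {i} → 0ℤ ≤ - i → i ≤ 0ℤ
0≤-i⇒i≤0 {i} 0≤-i = subst (_≤ 0ℤ) (ℤ.neg-involutive i) (ℤ.neg-mono-≤ 0≤-i)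

μ₁-nonneg : ∀ A {x} y → 0ℤ ≤ x → μ A zero (x , y) ≡ (x , - y)
μ₁-nonneg A {x} y 0≤x = cong (x ,_) (begin
  A * [ - x ]₊ - y   ≡⟨ cong (λ v → A * v - y) (ℤ.i≤j⇒i⊔j≡j (ℤ.neg-mono-≤ 0≤x)) ⟩
  A * 0ℤ - y         ≡⟨ cong (_- y) (ℤ.*-zeroʳ A) ⟩
  0ℤ - y             ≡⟨ ℤ.+-identityˡ (- y) ⟩
  - y                ∎)

μ₁-nonpos : ∀ A {x} y → 0ℤ ≤ - x → μ A zero (x , y) ≡ (x , A * - x - y)
μ₁-nonpos A {x} y 0≤-x = cong (λ v → x , A * v - y) (ℤ.i≥j⇒i⊔j≡i 0≤-x)

μ₂-nonneg : ∀ A x {y} → 0ℤ ≤ y → μ A (suc zero) (x , y) ≡ (- x - A * y , y)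
μ₂-nonneg A x {y} 0≤y = cong (λ v → - x - A * v , y) (ℤ.i≥j⇒i⊔j≡i 0≤y)

μ₂-nonpos : ∀ A x {y} → 0ℤ ≤ - y → μ A (suc zero) (x , y) ≡ (- x , y)
μ₂-nonpos A x {y} 0≤-y = cong (_, y) (begin
  - x - A * [ y ]₊   ≡⟨ cong (λ v → - x - A * v) (ℤ.i≤j⇒i⊔j≡j (0≤-i⇒i≤0 0≤-y)) ⟩
  - x - A * 0ℤ       ≡⟨ cong (λ v → - x - v) (ℤ.*-zeroʳ A) ⟩
  - x - 0ℤ           ≡⟨ ℤ.+-identityʳ (- x) ⟩
  - x                ∎)

-- a = 1: the orbit stays in a box

-- Only x - y ≤ K is invariant, not |x - y| ≤ K: with K = 7 the orbit of (2 , 5) contains (-7 , 2).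
Box : ℤ → ℤ × ℤ → Set
Box K (x , y) = 0ℤ ≤ K - x × 0ℤ ≤ K - - x × 0ℤ ≤ K - y × 0ℤ ≤ K - - y ×
                0ℤ ≤ K - (x + y) × 0ℤ ≤ K - - (x + y) × 0ℤ ≤ K - (x - y)

box-initial : ∀ X Y x y → 0ℤ ≤ X → 0ℤ ≤ Y → 0ℤ ≤ X - x → 0ℤ ≤ X - - x → 0ℤ ≤ Y - y → 0ℤ ≤ Y - - y →
              Box (X + Y) (x , y)
box-initial X Y x y 0≤X 0≤Y hx h-x hy h-y =
  0≤-by (ℤ.+-mono-≤ hx 0≤Y) (solve (X ∷ Y ∷ x ∷ [])) ,
  0≤-by (ℤ.+-mono-≤ h-x 0≤Y) (solve (X ∷ Y ∷ x ∷ [])) ,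
  0≤-by (ℤ.+-mono-≤ 0≤X hy) (solve (X ∷ Y ∷ y ∷ [])) ,
  0≤-by (ℤ.+-mono-≤ 0≤X h-y) (solve (X ∷ Y ∷ y ∷ [])) ,
  0≤-by (ℤ.+-mono-≤ hx hy) (solve (X ∷ Y ∷ x ∷ y ∷ [])) ,
  0≤-by (ℤ.+-mono-≤ h-x h-y) (solve (X ∷ Y ∷ x ∷ y ∷ [])) ,
  0≤-by (ℤ.+-mono-≤ hx h-y) (solve (X ∷ Y ∷ x ∷ y ∷ []))

box-μ : ∀ {K} k t → Box K t → Box K (μ (+ 1) k t)
box-μ {K} zero (x , y) (hx , h-x , hy , h-y , hs , h-s , hd) with ℤ.≤-total 0ℤ x
... | inj₁ 0≤x = subst (Box K) (sym (μ₁-nonneg (+ 1) y 0≤x)) (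
  hx , h-x , h-y , 0≤-by hy (solve (K ∷ y ∷ [])) , hd ,
  0≤-by (ℤ.+-mono-≤ hy 0≤x) (solve (K ∷ x ∷ y ∷ [])) ,
  0≤-by hs (solve (K ∷ x ∷ y ∷ [])))
... | inj₂ x≤0 = subst (Box K) (sym (μ₁-nonpos (+ 1) y 0≤-x)) (
  hx , h-x , 0≤-by h-s (solve (K ∷ x ∷ y ∷ [])) , 0≤-by hs (solve (K ∷ x ∷ y ∷ [])) ,
  0≤-by h-y (solve (K ∷ x ∷ y ∷ [])) , 0≤-by hy (solve (K ∷ x ∷ y ∷ [])) ,
  0≤-by (ℤ.+-mono-≤ hs 0≤-x) (solve (K ∷ x ∷ y ∷ [])))
  where
  0≤-x : 0ℤ ≤ - x
  0≤-x = ℤ.neg-mono-≤ x≤0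
box-μ {K} (suc zero) (x , y) (hx , h-x , hy , h-y , hs , h-s , hd) with ℤ.≤-total 0ℤ y
... | inj₁ 0≤y = subst (Box K) (sym (μ₂-nonneg (+ 1) x 0≤y)) (
  0≤-by h-s (solve (K ∷ x ∷ y ∷ [])) , 0≤-by hs (solve (K ∷ x ∷ y ∷ [])) , hy , h-y ,
  0≤-by h-x (solve (K ∷ x ∷ y ∷ [])) , 0≤-by hx (solve (K ∷ x ∷ y ∷ [])) ,
  0≤-by (ℤ.+-mono-≤ h-s 0≤y) (solve (K ∷ x ∷ y ∷ [])))
... | inj₂ y≤0 = subst (Box K) (sym (μ₂-nonpos (+ 1) x 0≤-y)) (
  h-x , 0≤-by hx (solve (K ∷ x ∷ [])) , hy , h-y ,
  0≤-by (ℤ.+-mono-≤ h-x 0≤-y) (solve (K ∷ x ∷ y ∷ [])) ,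
  0≤-by hd (solve (K ∷ x ∷ y ∷ [])) , 0≤-by h-s (solve (K ∷ x ∷ y ∷ [])))
  where
  0≤-y : 0ℤ ≤ - y
  0≤-y = ℤ.neg-mono-≤ y≤0

orbit-box : ∀ K {s t} → Box K s → Orbit (+ 1) s t → Box K t
orbit-box K b here       = b
orbit-box K b (step o k) = box-μ {K} k _ (orbit-box K b o)

range : ℕ → List ℤ
range k = map +_ (upTo (suc k)) ++ map -[1+_] (upTo k)

∈-range : ∀ {k z} → 0ℤ ≤ + k - z → 0ℤ ≤ + k - - z → z ∈ range k
∈-range     {z = + m}      z≤k _  = ∈-++⁺ˡ (∈-map⁺ +_ (∈-upTo⁺ (ℕ.s≤s (ℤ.drop‿+≤+ (ℤ.0≤i-j⇒j≤i z≤k)))))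
∈-range {k} {z = -[1+ m ]} _ -z≤k =
  ∈-++⁺ʳ (map +_ (upTo (suc k))) (∈-map⁺ -[1+_] (∈-upTo⁺ (ℤ.drop‿+≤+ (ℤ.0≤i-j⇒j≤i -z≤k))))

i≤∣i∣ : ∀ i → i ≤ + ∣ i ∣
i≤∣i∣ (+ n)      = ℤ.≤-refl
i≤∣i∣ -[1+ n ]   = -≤+

0≤∣i∣-i : ∀ i → 0ℤ ≤ + ∣ i ∣ - i
0≤∣i∣-i i = ℤ.i≤j⇒0≤j-i (i≤∣i∣ i)

0≤∣i∣+i : ∀ i → 0ℤ ≤ + ∣ i ∣ - - i
0≤∣i∣+i i = subst (λ n → 0ℤ ≤ + n - - i) (ℤ.∣-i∣≡∣i∣ i) (0≤∣i∣-i (- i))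

finite-class-a≡1 : ∀ x y → FiniteMutationClass (quiverWithFrozen 1 x y)
finite-class-a≡1 x y = finite-orbit⇒finite-class (cartesianProduct (range k) (range k)) in-box
  where
  k = ∣ x ∣ ℕ.+ ∣ y ∣
  initial : Box (+ k) (x , y)
  initial = box-initial (+ ∣ x ∣) (+ ∣ y ∣) x y (+≤+ z≤n) (+≤+ z≤n)
                        (0≤∣i∣-i x) (0≤∣i∣+i x) (0≤∣i∣-i y) (0≤∣i∣+i y)
  in-box : ∀ {t} → Orbit (+ 1) (x , y) t → t ∈ cartesianProduct (range k) (range k)
  in-box {_ , _} o with orbit-box (+ k) initial o
  ... | hu , h-u , hv , h-v , _ = ∈-cartesianProduct⁺ (∈-range hu h-u) (∈-range hv h-v)

-- a = 2 and b₁ = -b₂ ≤ 0: a fixed point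

antidiagonal-fixed : ∀ {x} → 0ℤ ≤ - x → ∀ k → μ (+ 2) k (x , - x) ≡ (x , - x)
antidiagonal-fixed {x} 0≤-x zero = begin
  μ (+ 2) zero (x , - x)     ≡⟨ μ₁-nonpos (+ 2) (- x) 0≤-x ⟩
  x , + 2 * - x - - x        ≡⟨ cong (x ,_) (solve (x ∷ [])) ⟩
  x , - x                    ∎
antidiagonal-fixed {x} 0≤-x (suc zero) = begin
  μ (+ 2) (suc zero) (x , - x)   ≡⟨ μ₂-nonneg (+ 2) x 0≤-x ⟩
  - x - + 2 * - x , - x          ≡⟨ cong (_, - x) (solve (x ∷ [])) ⟩
  x , - x                        ∎

antidiagonal-orbit : ∀ {x t} → 0ℤ ≤ - x → Orbit (+ 2) (x , - x) t → t ≡ (x , - x)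
antidiagonal-orbit 0≤-x here = refl
antidiagonal-orbit 0≤-x (step o k) rewrite antidiagonal-orbit 0≤-x o = antidiagonal-fixed 0≤-x k

finite-class-antidiagonal : ∀ {x} → 0ℤ ≤ - x → FiniteMutationClass (quiverWithFrozen 2 x (- x))
finite-class-antidiagonal {x} 0≤-x =
  finite-orbit⇒finite-class ((x , - x) ∷ []) (λ o → here (antidiagonal-orbit 0≤-x o))

-- a ≥ 2 otherwise: escape to infinity

dual : ℤ × ℤ → ℤ × ℤ
dual (x , y) = - y , - x

other : Fin 2 → Fin 2
other zero       = suc zero
other (suc zero) = zero

dual-μ : ∀ A k t → dual (μ A k t) ≡ μ A (other k) (dual t)
dual-μ A zero (x , y) = cong (_, - x) (ring₁ (A * [ - x ]₊) y)
  where
  ring₁ : ∀ v y → - (v - y) ≡ - - y - v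
  ring₁ = solve-∀
dual-μ A (suc zero) (x , y) = cong (- y ,_) (begin
  - (- x - A * [ y ]₊)       ≡⟨ ring₂ x (A * [ y ]₊) ⟩
  A * [ y ]₊ - - x           ≡⟨ cong (λ v → A * [ v ]₊ - - x) (ℤ.neg-involutive y) ⟨
  A * [ - - y ]₊ - - x       ∎)
  where
  ring₂ : ∀ x v → - (- x - v) ≡ v - - x
  ring₂ = solve-∀

dual-involutive : ∀ t → dual (dual t) ≡ t
dual-involutive (x , y) = cong₂ _,_ (ℤ.neg-involutive x) (ℤ.neg-involutive y)

‖dual‖ : ∀ t → ‖ dual t ‖ ≡ ‖ t ‖
‖dual‖ (x , y) = trans (cong₂ ℕ._+_ (ℤ.∣-i∣≡∣i∣ y) (ℤ.∣-i∣≡∣i∣ x)) (ℕ.+-comm ∣ y ∣ ∣ x ∣)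

orbit-dual : ∀ {A s t} → Orbit A s t → Orbit A (dual s) (dual t)
orbit-dual here       = here
orbit-dual (step o k) = subst (Orbit _ _) (sym (dual-μ _ k _)) (step (orbit-dual o) (other k))

orbit-trans : ∀ {A s t u} → Orbit A s t → Orbit A t u → Orbit A s u
orbit-trans o here        = o
orbit-trans o (step o′ k) = step (orbit-trans o o′) k

unbounded-dual : ∀ {A s} → Unbounded A (dual s) → Unbounded A s
unbounded-dual {s = s} unbounded m with unbounded m
... | t , o , large = dual t , subst (λ s′ → Orbit _ s′ (dual t)) (dual-involutive s) (orbit-dual o) ,
                      subst (m ℕ.≤_) (sym (‖dual‖ t)) large

unbounded-orbit-trans : ∀ {A s t} → Orbit A s t → Unbounded A t → Unbounded A s
unbounded-orbit-trans o unbounded m with unbounded m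
... | u , o′ , large = u , orbit-trans o o′ , large

NegativeCone : ℤ × ℤ → Set
NegativeCone (x , y) = 0ℤ < - x × 0ℤ < - (x + y)

PositiveCone : ℤ × ℤ → Set
PositiveCone (x , y) = 0ℤ < y × 0ℤ < x + y

dual-positiveCone : ∀ {x y} → PositiveCone (x , y) → NegativeCone (- y , - x)
dual-positiveCone {x} {y} (0<y , 0<x+y) =
  0<-by 0<y (sym (ℤ.neg-involutive y)) , 0<-by 0<x+y (solve (x ∷ y ∷ []))

-- With a = A - 2 (a = A - 3 in antidiagonal-unbounded), each inequality exhibits the quantity
-- as a positive term plus products of nonnegative ones.
negativeCone-step : ∀ {A} → + 2 ≤ A → ∀ {t} → NegativeCone t →
                    let t′ = μ A (suc zero) (μ A zero t) in NegativeCone t′ × - proj₁ t < - proj₁ t′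
negativeCone-step {A} 2≤A {x , y} (0<-x , 0<-[x+y]) =
  subst (λ t′ → NegativeCone t′ × - x < - proj₁ t′) (sym twice) ((ℤ.<-trans 0<-x grows , 0<-[x″+y″]) , grows)
  where
  0≤a : 0ℤ ≤ A - + 2
  0≤a = ℤ.i≤j⇒0≤j-i 2≤A
  0≤A : 0ℤ ≤ A
  0≤A = ℤ.≤-trans (+≤+ z≤n) 2≤A
  0≤-x : 0ℤ ≤ - x
  0≤-x = ℤ.<⇒≤ 0<-x
  0≤-[x+y] : 0ℤ ≤ - (x + y)
  0≤-[x+y] = ℤ.<⇒≤ 0<-[x+y]
  0≤y′ : 0ℤ ≤ A * - x - y
  0≤y′ = 0≤-by (ℤ.+-mono-≤ 0≤-[x+y] (ℤ.+-mono-≤ 0≤-x (*-nonneg 0≤a 0≤-x))) (solve (A ∷ x ∷ y ∷ []))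
  twice : μ A (suc zero) (μ A zero (x , y)) ≡ (- x - A * (A * - x - y) , A * - x - y)
  twice = trans (cong (μ A (suc zero)) (μ₁-nonpos A y 0≤-x)) (μ₂-nonneg A x 0≤y′)
  grows : - x < - (- x - A * (A * - x - y))
  grows = <-by (ℤ.+-mono-<-≤ 0<-[x+y] (ℤ.+-mono-≤ 0≤-[x+y] (ℤ.+-mono-≤ (*-nonneg 0≤a 0≤-[x+y])
                  (*-nonneg (*-nonneg 0≤a (ℤ.+-mono-≤ 0≤a (ℤ.nonNegative⁻¹ (+ 3)))) 0≤-x))))
               (solve (A ∷ x ∷ y ∷ []))
  0<-[x″+y″] : 0ℤ < - ((- x - A * (A * - x - y)) + (A * - x - y))
  0<-[x″+y″] = 0<-by (ℤ.+-mono-<-≤ 0<-[x+y]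
                   (ℤ.+-mono-≤ (*-nonneg 0≤a 0≤-[x+y]) (*-nonneg (*-nonneg 0≤A 0≤a) 0≤-x)))
                 (solve (A ∷ x ∷ y ∷ []))

≤-neg⇒≤∣∣ : ∀ {m x} → + m ≤ - x → m ℕ.≤ ∣ x ∣
≤-neg⇒≤∣∣ {x = + zero}   (+≤+ m≤0) = m≤0
≤-neg⇒≤∣∣ {x = -[1+ k ]} (+≤+ m≤k) = m≤k

negativeCone-unbounded : ∀ {A} → + 2 ≤ A → ∀ {s} → NegativeCone s → Unbounded A s
negativeCone-unbounded {A} 2≤A {x , y} cone m =
  let (t , o , _ , m≤-x) = iterate m in t , o , ℕ.≤-trans (≤-neg⇒≤∣∣ m≤-x) (ℕ.m≤m+n _ _)
  where
  iterate : ∀ m → ∃[ t ] Orbit A (x , y) t × NegativeCone t × + m ≤ - proj₁ t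
  iterate zero = (x , y) , here , cone , ℤ.<⇒≤ (proj₁ cone)
  iterate (suc m) with iterate m
  ... | t , o , cone-t , m≤-x with negativeCone-step 2≤A cone-t
  ... | cone′ , grows =
    _ , step (step o zero) (suc zero) , cone′ , ℤ.i<j⇒suc[i]≤j (ℤ.≤-<-trans m≤-x grows)

positiveCone-unbounded : ∀ {A} → + 2 ≤ A → ∀ {s} → PositiveCone s → Unbounded A s
positiveCone-unbounded 2≤A {x , y} cone = unbounded-dual (negativeCone-unbounded 2≤A (dual-positiveCone cone))

fourthQuadrant-unbounded : ∀ {A} → + 2 ≤ A → ∀ {x y} → 0ℤ ≤ x → 0ℤ ≤ - y → 0ℤ < x - y → Unbounded A (x , y)
fourthQuadrant-unbounded {A} 2≤A {x} {y} 0≤x 0≤-y 0<x-y = unbounded-orbit-trans (step (step here (suc zero)) zero)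
  (positiveCone-unbounded 2≤A (subst PositiveCone (sym twice) (0<y′ , 0<x′+y′)))
  where
  0≤a : 0ℤ ≤ A - + 2
  0≤a = ℤ.i≤j⇒0≤j-i 2≤A
  twice : μ A zero (μ A (suc zero) (x , y)) ≡ (- x , A * - - x - y)
  twice = trans (cong (μ A zero) (μ₂-nonpos A x 0≤-y))
                (μ₁-nonpos A y (subst (0ℤ ≤_) (sym (ℤ.neg-involutive x)) 0≤x))
  0<y′ : 0ℤ < A * - - x - y
  0<y′ = 0<-by (ℤ.+-mono-<-≤ 0<x-y (*-nonneg (ℤ.+-mono-≤ 0≤a (ℤ.nonNegative⁻¹ (+ 1))) 0≤x))
           (solve (A ∷ x ∷ y ∷ []))
  0<x′+y′ : 0ℤ < - x + (A * - - x - y)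
  0<x′+y′ = 0<-by (ℤ.+-mono-<-≤ 0<x-y (*-nonneg 0≤a 0≤x)) (solve (A ∷ x ∷ y ∷ []))

antidiagonal-unbounded : ∀ {A} → + 3 ≤ A → ∀ {x y} → 0ℤ < - x → y ≡ - x → Unbounded A (x , y)
antidiagonal-unbounded {A} 3≤A {x} 0<-x refl = unbounded-orbit-trans (step (step here (suc zero)) zero)
  (positiveCone-unbounded 2≤A (subst PositiveCone (sym twice) (0<y′ , 0<x′+y′)))
  where
  0≤a : 0ℤ ≤ A - + 3
  0≤a = ℤ.i≤j⇒0≤j-i 3≤A
  2≤A : + 2 ≤ A
  2≤A = ℤ.≤-trans (+≤+ (ℕ.s≤s (ℕ.s≤s z≤n))) 3≤A
  0≤-x : 0ℤ ≤ - x
  0≤-x = ℤ.<⇒≤ 0<-x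
  0≤-x₁ : 0ℤ ≤ - (- x - A * - x)
  0≤-x₁ = 0≤-by (*-nonneg (ℤ.+-mono-≤ 0≤a (ℤ.nonNegative⁻¹ (+ 2))) 0≤-x) (solve (A ∷ x ∷ []))
  twice : μ A zero (μ A (suc zero) (x , - x)) ≡ (- x - A * - x , A * - (- x - A * - x) - - x)
  twice = trans (cong (μ A zero) (μ₂-nonneg A x 0≤-x)) (μ₁-nonpos A (- x) 0≤-x₁)
  0<y′ : 0ℤ < A * - (- x - A * - x) - - x
  0<y′ = 0<-by (ℤ.+-mono-<-≤ 0<-x (*-nonneg (ℤ.+-mono-≤ (*-nonneg 0≤a (ℤ.+-mono-≤ 0≤a (ℤ.nonNegative⁻¹ (+ 5))))
                                                        (ℤ.nonNegative⁻¹ (+ 4))) 0≤-x))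
           (solve (A ∷ x ∷ []))
  0<x′+y′ : 0ℤ < (- x - A * - x) + (A * - (- x - A * - x) - - x)
  0<x′+y′ = 0<-by (ℤ.+-mono-<-≤ 0<-x (*-nonneg (ℤ.+-mono-≤ (*-nonneg 0≤a (ℤ.+-mono-≤ 0≤a (ℤ.nonNegative⁻¹ (+ 4))))
                                                           (ℤ.nonNegative⁻¹ (+ 2))) 0≤-x))
              (solve (A ∷ x ∷ []))

negative-x-unbounded : ∀ {A} → + 2 ≤ A → ∀ {x y} → 0ℤ < - x → (x + y ≡ 0ℤ → + 3 ≤ A) → Unbounded A (x , y)
negative-x-unbounded 2≤A {x} {y} 0<-x antidiagonal⇒3≤A with ℤ.<-cmp (x + y) 0ℤ
... | tri< x+y<0 _ _ = negativeCone-unbounded 2≤A (0<-x , ℤ.neg-mono-< x+y<0)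
... | tri≈ _ x+y≡0 _ = antidiagonal-unbounded (antidiagonal⇒3≤A x+y≡0) 0<-x (inverseʳ-unique x y x+y≡0)
... | tri> _ _ 0<x+y =
  positiveCone-unbounded 2≤A {x , y} (0<-by (ℤ.+-mono-< 0<x+y 0<-x) (solve (x ∷ y ∷ [])) , 0<x+y)

nonnegative-x-unbounded : ∀ {A} → + 2 ≤ A → ∀ {x y} → 0ℤ ≤ x → (y ≡ 0ℤ → 0ℤ < x - y) → Unbounded A (x , y)
nonnegative-x-unbounded 2≤A {x} {y} 0≤x y≡0⇒0<x-y with ℤ.<-cmp y 0ℤ
... | tri< y<0 _ _ = fourthQuadrant-unbounded 2≤A 0≤x (ℤ.<⇒≤ (ℤ.neg-mono-< y<0)) (ℤ.+-mono-≤-< 0≤x (ℤ.neg-mono-< y<0))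
... | tri≈ _ y≡0 _ = fourthQuadrant-unbounded 2≤A 0≤x (ℤ.≤-reflexive (cong -_ (sym y≡0))) (y≡0⇒0<x-y y≡0)
... | tri> _ _ 0<y = positiveCone-unbounded 2≤A (0<y , ℤ.+-mono-≤-< 0≤x 0<y)

orbit-unbounded : ∀ {A} → + 2 ≤ A → ∀ {x y} → ¬ (x ≡ 0ℤ × y ≡ 0ℤ) →
                  (x + y ≡ 0ℤ → 0ℤ < - x → + 3 ≤ A) → Unbounded A (x , y)
orbit-unbounded 2≤A {x} {y} nonzero antidiagonal⇒3≤A with ℤ.<-cmp x 0ℤ
... | tri< x<0 _ _ =
  negative-x-unbounded 2≤A (ℤ.neg-mono-< x<0) (λ x+y≡0 → antidiagonal⇒3≤A x+y≡0 (ℤ.neg-mono-< x<0))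
... | tri≈ _ x≡0 _ =
  nonnegative-x-unbounded 2≤A (ℤ.≤-reflexive (sym x≡0)) (λ y≡0 → ⊥-elim (nonzero (x≡0 , y≡0)))
... | tri> _ _ 0<x =
  nonnegative-x-unbounded 2≤A (ℤ.<⇒≤ 0<x) (λ y≡0 → ℤ.+-mono-<-≤ 0<x (ℤ.≤-reflexive (cong -_ (sym y≡0))))

finite⇒antidiagonal : ∀ {x y} → ¬ (x ≡ 0ℤ × y ≡ 0ℤ) → FiniteMutationClass (quiverWithFrozen 2 x y) →
                      x + y ≡ 0ℤ × 0ℤ < - x
finite⇒antidiagonal {x} {y} nonzero finite =
  decidable-stable (x + y ℤ.≟ 0ℤ ×-dec 0ℤ ℤ.<? - x) λ off-antidiagonal → unbounded-orbit⇒infinite-class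
    (orbit-unbounded ℤ.≤-refl nonzero (λ x+y≡0 0<-x → ⊥-elim (off-antidiagonal (x+y≡0 , 0<-x)))) finite

theorem7p1 : (a : ℕ) → a > 0 → (b₁ b₂ : ℤ) →
    (a ≡ 1 → ¬ (b₁ ≡ 0ℤ × b₂ ≡ 0ℤ) → Admissible a b₁ b₂)
    × (a ≡ 2 → (Admissible a b₁ b₂ ⇔ (b₁ ≡ - b₂ × b₁ ≤ 0ℤ × ¬ (b₁ ≡ 0ℤ × b₂ ≡ 0ℤ))))
    × (a > 2 → ¬ Admissible a b₁ b₂)
theorem7p1 zero    ()
theorem7p1 (suc n) _ b₁ b₂ = a≡1 , a≡2 , a>2
  where
  a≡1 : suc n ≡ 1 → ¬ (b₁ ≡ 0ℤ × b₂ ≡ 0ℤ) → Admissible (suc n) b₁ b₂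
  a≡1 refl nonzero = nonzero , finite-class-a≡1 b₁ b₂
  a≡2 : suc n ≡ 2 → (Admissible (suc n) b₁ b₂ ⇔ (b₁ ≡ - b₂ × b₁ ≤ 0ℤ × ¬ (b₁ ≡ 0ℤ × b₂ ≡ 0ℤ)))
  a≡2 refl = mk⇔
    (λ (nonzero , finite) → let (b₁+b₂≡0 , 0<-b₁) = finite⇒antidiagonal nonzero finite in
       inverseˡ-unique b₁ b₂ b₁+b₂≡0 , 0≤-i⇒i≤0 (ℤ.<⇒≤ 0<-b₁) , nonzero)
    (λ (b₁≡-b₂ , b₁≤0 , nonzero) → nonzero ,
       subst (FiniteMutationClass ∘ quiverWithFrozen 2 b₁) (trans (cong -_ b₁≡-b₂) (ℤ.neg-involutive b₂))
             (finite-class-antidiagonal (ℤ.neg-mono-≤ b₁≤0)))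
  a>2 : suc n > 2 → ¬ Admissible (suc n) b₁ b₂
  a>2 2<a (nonzero , finite) =
    unbounded-orbit⇒infinite-class (orbit-unbounded (+≤+ (ℕ.<⇒≤ 2<a)) nonzero (λ _ _ → +≤+ 2<a)) finite
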